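{- Let $\mathcal A$ be a deterministic, uniquely represented streaming algorithm maintaining a signed multiset over a set $S$ of $n$ items, using fewer than $n$ bits of storage (so it has at most $2^k$ states for some $k<n$), with associated map $u$ from signed multisets to states. Then there is a nonempty unit multiset $D$ over $S$ with $u(D)=u(\emptyset)$, i.e. the algorithm cannot distinguish $D$ from the empty multiset.
   Context: A signed multiset over a finite set $S$ is a map $f:S\to\mathbb Z$; it is empty if $f\equiv 0$, and it is a unit multiset if $f(x)\in\{ -1,0,1\}$ for all $x$. Inserting $x$ increases $f(x)$ by one; deleting $x$ decreases $f(x)$ by one; signed multisets form a commutative group $M$ under pointwise addition. A deterministic streaming algorithm maintaining a signed multiset has a fixed initial state and processes insert/delete operations one at a time, each operation deterministically transforming the current state. It is uniquely represented if there is a map $u$ from $M$ to states such that after any sequence of updates producing multiset $A$ (regardless of order) the state is $u(A)$. -}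

module Defs where

open import Data.Nat using (ℕ)
open import Data.Integer using (ℤ; +_; -[1+_]; _+_; _-_; 1ℤ; 0ℤ)
open import Data.Fin using (Fin)
open import Data.Vec using (Vec; replicate; updateAt)
open import Data.Vec.Relation.Unary.All using (All)
open import Data.List using (List; foldl)
open import Data.Sum using (_⊎_)
open import Relation.Binary.PropositionalEquality using (_≡_)

-- A signed multiset over S = Fin n: the map f : S → ℤ, stored as its table of values.
SignedMultiset : ℕ → Set
SignedMultiset n = Vec ℤ n

∅ : ∀ {n} → SignedMultiset n
∅ = replicate _ 0ℤ

IsUnit : ∀ {n} → SignedMultiset n → Set
IsUnit = All (λ z → z ≡ 0ℤ ⊎ z ≡ 1ℤ ⊎ z ≡ -[1+ 0 ])

data Op (n : ℕ) : Set where
  ins : Fin n → Op n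
  del : Fin n → Op n

applyOp : ∀ {n} → SignedMultiset n → Op n → SignedMultiset n
applyOp f (ins x) = updateAt f x (λ z → z + 1ℤ)
applyOp f (del x) = updateAt f x (λ z → z - 1ℤ)

multisetOf : ∀ {n} → List (Op n) → SignedMultiset n
multisetOf = foldl applyOp ∅

record StreamingAlgorithm (n : ℕ) (Q : Set) : Set where
  field
    initial : Q
    step    : Q → Op n → Q

run : ∀ {n Q} → StreamingAlgorithm n Q → List (Op n) → Q
run A = foldl (StreamingAlgorithm.step A) (StreamingAlgorithm.initial A)

UniquelyRepresentedBy : ∀ {n Q} → StreamingAlgorithm n Q → (SignedMultiset n → Q) → Set
UniquelyRepresentedBy A u = ∀ ops → run A ops ≡ u (multisetOf ops)

module Submission where

-- Identify a subset X of S = Fin n with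
-- its characteristic function X : Fin n → Fin 2.  For every subset X run
-- the algorithm on the stream "insert every element of X"; there are
-- 2 ^ n > 2 ^ k ≥ m subsets but only m states, so by the pigeonhole
-- principle two different subsets X ≠ Y reach the same state.  Because the
-- state after a stream depends only on the multiset it produces, appending
-- the common suffix "delete every element of Y" keeps the states equal:
--   u (1_X − 1_Y) = u (1_Y − 1_Y) = u ∅,
-- and D = 1_X − 1_Y is a nonzero unit multiset.

open import Defs
open import Data.Nat using (ℕ; _<_; _≤_; _^_)
open import Data.Fin using (Fin)
open import Data.Product using (Σ; _×_)
open import Relation.Binary.PropositionalEquality using (_≡_; _≢_)

open import Data.Bool using (Bool; true; false)
open import Data.Nat using (s≤s; z≤n)
open import Data.Nat.Properties using (≤-<-trans; ^-monoʳ-<)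
open import Data.Fin using (zero; suc; finToFun; funToFin; combine)
open import Data.Fin.Properties using (pigeonhole; funToFin-finToFin; <⇒≢)
open import Data.Integer using (ℤ; -[1+_]; _+_; _-_; 0ℤ; 1ℤ)
open import Data.Vec using (Vec; []; _∷_; tabulate; lookup)
open import Data.Vec.Properties using (lookup∘tabulate; lookup-replicate; tabulate-cong; tabulate∘lookup)
open import Data.Vec.Relation.Unary.All.Properties using (tabulate⁺)
open import Data.List using (List; []; _∷_; _++_; foldl; map)
open import Data.List.Properties using (foldl-++)
open import Data.Sum using (_⊎_; inj₁; inj₂)
open import Data.Product using (_,_)
open import Relation.Nullary using (¬_)
open import Function using (_∘_)
open import Relation.Binary.PropositionalEquality using (refl; sym; trans; cong; cong₂; _≗_; module ≡-Reasoning)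

run-++ : ∀ {n Q} (A : StreamingAlgorithm n Q) (as cs : List (Op n)) →
         run A (as ++ cs) ≡ foldl (StreamingAlgorithm.step A) (run A as) cs
run-++ A as cs = foldl-++ (StreamingAlgorithm.step A) (StreamingAlgorithm.initial A) as cs

-- If two streams produce multisets with the same representation, so do
-- their extensions by any common suffix: the algorithm's state determines
-- its whole future.
collisions-persist : ∀ {n Q} (A : StreamingAlgorithm n Q) (u : SignedMultiset n → Q) →
                     UniquelyRepresentedBy A u → (as bs cs : List (Op n)) →
                     u (multisetOf as) ≡ u (multisetOf bs) →
                     u (multisetOf (as ++ cs)) ≡ u (multisetOf (bs ++ cs))
collisions-persist A u unique as bs cs same = begin
  u (multisetOf (as ++ cs))  ≡⟨ sym (unique (as ++ cs)) ⟩
  run A (as ++ cs)           ≡⟨ run-++ A as cs ⟩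
  foldl step (run A as) cs   ≡⟨ cong (λ q → foldl step q cs) sameRun ⟩
  foldl step (run A bs) cs   ≡⟨ sym (run-++ A bs cs) ⟩
  run A (bs ++ cs)           ≡⟨ unique (bs ++ cs) ⟩
  u (multisetOf (bs ++ cs))  ∎
  where
  open ≡-Reasoning
  open StreamingAlgorithm A using (step)
  sameRun : run A as ≡ run A bs
  sameRun = trans (unique as) (trans same (sym (unique bs)))

update : ∀ {n} → Bool → Fin n → Op n
update true  = ins
update false = del

bump : Bool → ℤ → ℤ
bump true  z = z + 1ℤ
bump false z = z - 1ℤ

bumpIf : Bool → Fin 2 → ℤ → ℤ
bumpIf s zero       z = z
bumpIf s (suc zero) z = bump s z

shiftOp : ∀ {n} → Op n → Op (ℕ.suc n)
shiftOp (ins x) = ins (suc x)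
shiftOp (del x) = del (suc x)

updateFirstIf : ∀ {n} → Bool → Fin 2 → List (Op (ℕ.suc n))
updateFirstIf s zero       = []
updateFirstIf s (suc zero) = update s zero ∷ []

updatesOn : ∀ {n} → Bool → (Fin n → Fin 2) → List (Op n)
updatesOn {ℕ.zero}  s X = []
updatesOn {ℕ.suc n} s X = updateFirstIf s (X zero) ++ map shiftOp (updatesOn s (X ∘ suc))

foldl-shiftOp : ∀ {n} (z : ℤ) (zs : Vec ℤ n) (ops : List (Op n)) →
                foldl applyOp (z ∷ zs) (map shiftOp ops) ≡ z ∷ foldl applyOp zs ops
foldl-shiftOp z zs []            = refl
foldl-shiftOp z zs (ins x ∷ ops) = foldl-shiftOp z _ ops
foldl-shiftOp z zs (del x ∷ ops) = foldl-shiftOp z _ ops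

foldl-updateFirstIf : ∀ {n} (s : Bool) (b : Fin 2) (z : ℤ) (zs : Vec ℤ n) →
                      foldl applyOp (z ∷ zs) (updateFirstIf s b) ≡ bumpIf s b z ∷ zs
foldl-updateFirstIf s     zero       z zs = refl
foldl-updateFirstIf true  (suc zero) z zs = refl
foldl-updateFirstIf false (suc zero) z zs = refl

foldl-updatesOn : ∀ {n} (s : Bool) (v : Vec ℤ n) (X : Fin n → Fin 2) →
                  foldl applyOp v (updatesOn s X) ≡ tabulate (λ i → bumpIf s (X i) (lookup v i))
foldl-updatesOn {ℕ.zero}  s [] X = refl
foldl-updatesOn {ℕ.suc n} s (z ∷ zs) X = begin
  foldl applyOp (z ∷ zs) (updateFirstIf s (X zero) ++ map shiftOp rest)
    ≡⟨ foldl-++ applyOp (z ∷ zs) (updateFirstIf s (X zero)) (map shiftOp rest) ⟩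
  foldl applyOp (foldl applyOp (z ∷ zs) (updateFirstIf s (X zero))) (map shiftOp rest)
    ≡⟨ cong (λ w → foldl applyOp w (map shiftOp rest)) (foldl-updateFirstIf s (X zero) z zs) ⟩
  foldl applyOp (bumpIf s (X zero) z ∷ zs) (map shiftOp rest)
    ≡⟨ foldl-shiftOp (bumpIf s (X zero) z) zs rest ⟩
  bumpIf s (X zero) z ∷ foldl applyOp zs rest
    ≡⟨ cong (bumpIf s (X zero) z ∷_) (foldl-updatesOn s zs (X ∘ suc)) ⟩
  tabulate (λ i → bumpIf s (X i) (lookup (z ∷ zs) i)) ∎
  where
  open ≡-Reasoning
  rest : List (Op n)
  rest = updatesOn s (X ∘ suc)

χ : Fin 2 → ℤ
χ zero       = 0ℤ
χ (suc zero) = 1ℤ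

indicatorDifference : ∀ {n} → (Fin n → Fin 2) → (Fin n → Fin 2) → SignedMultiset n
indicatorDifference X Y = tabulate (λ i → χ (X i) - χ (Y i))

bumps-χ : (a b : Fin 2) → bumpIf false b (bumpIf true a 0ℤ) ≡ χ a - χ b
bumps-χ zero       zero       = refl
bumps-χ zero       (suc zero) = refl
bumps-χ (suc zero) zero       = refl
bumps-χ (suc zero) (suc zero) = refl

multisetOf-insert-delete : ∀ {n} (X Y : Fin n → Fin 2) →
  multisetOf (updatesOn true X ++ updatesOn false Y) ≡ indicatorDifference X Y
multisetOf-insert-delete X Y = begin
  multisetOf (updatesOn true X ++ deletions)
    ≡⟨ foldl-++ applyOp ∅ (updatesOn true X) deletions ⟩
  foldl applyOp (multisetOf (updatesOn true X)) deletions
    ≡⟨ cong (λ w → foldl applyOp w deletions) (foldl-updatesOn true ∅ X) ⟩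
  foldl applyOp afterInsertions deletions
    ≡⟨ foldl-updatesOn false afterInsertions Y ⟩
  tabulate (λ i → bumpIf false (Y i) (lookup afterInsertions i))
    ≡⟨ tabulate-cong coordinate ⟩
  indicatorDifference X Y ∎
  where
  open ≡-Reasoning
  deletions : List (Op _)
  deletions = updatesOn false Y
  afterInsertions : SignedMultiset _
  afterInsertions = tabulate (λ i → bumpIf true (X i) (lookup ∅ i))
  coordinate : ∀ i → bumpIf false (Y i) (lookup afterInsertions i) ≡ χ (X i) - χ (Y i)
  coordinate i = trans
    (cong (bumpIf false (Y i))
          (trans (lookup∘tabulate _ i) (cong (bumpIf true (X i)) (lookup-replicate i 0ℤ))))
    (bumps-χ (X i) (Y i))

χ-difference-unit : (a b : Fin 2) →
  let z = χ a - χ b in z ≡ 0ℤ ⊎ z ≡ 1ℤ ⊎ z ≡ -[1+ 0 ]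
χ-difference-unit zero       zero       = inj₁ refl
χ-difference-unit zero       (suc zero) = inj₂ (inj₂ refl)
χ-difference-unit (suc zero) zero       = inj₂ (inj₁ refl)
χ-difference-unit (suc zero) (suc zero) = inj₁ refl

χ-difference-zero : (a b : Fin 2) → χ a - χ b ≡ 0ℤ → a ≡ b
χ-difference-zero zero       zero       _ = refl
χ-difference-zero (suc zero) (suc zero) _ = refl
χ-difference-zero zero       (suc zero) ()
χ-difference-zero (suc zero) zero       ()

indicatorDifference-unit : ∀ {n} (X Y : Fin n → Fin 2) → IsUnit (indicatorDifference X Y)
indicatorDifference-unit X Y = tabulate⁺ (λ i → χ-difference-unit (X i) (Y i))

indicatorDifference-self : ∀ {n} (X : Fin n → Fin 2) → indicatorDifference X X ≡ ∅
indicatorDifference-self X = begin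
  tabulate (λ i → χ (X i) - χ (X i)) ≡⟨ tabulate-cong coordinate ⟩
  tabulate (lookup ∅)                 ≡⟨ tabulate∘lookup ∅ ⟩
  ∅                                   ∎
  where
  open ≡-Reasoning
  coordinate : ∀ i → χ (X i) - χ (X i) ≡ lookup ∅ i
  coordinate i with X i
  ... | zero     = sym (lookup-replicate i 0ℤ)
  ... | suc zero = sym (lookup-replicate i 0ℤ)

indicatorDifference-empty : ∀ {n} (X Y : Fin n → Fin 2) → indicatorDifference X Y ≡ ∅ → X ≗ Y
indicatorDifference-empty X Y empty i = χ-difference-zero (X i) (Y i)
  (trans (sym (lookup∘tabulate (λ j → χ (X j) - χ (Y j)) i))
         (trans (cong (λ v → lookup v i) empty) (lookup-replicate i 0ℤ)))

funToFin-cong : ∀ {m n} {f g : Fin m → Fin n} → f ≗ g → funToFin f ≡ funToFin g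
funToFin-cong {ℕ.zero}  _     = refl
funToFin-cong {ℕ.suc m} f≗g = cong₂ combine (f≗g zero) (funToFin-cong (f≗g ∘ suc))

finToFun-injective : ∀ {m n} (i j : Fin (m ^ n)) → finToFun {m} {n} i ≗ finToFun j → i ≡ j
finToFun-injective {m} {n} i j same = begin
  i                                   ≡⟨ sym (funToFin-finToFin {n} {m} i) ⟩
  funToFin {n} {m} (finToFun {m} {n} i) ≡⟨ funToFin-cong {n} {m} same ⟩
  funToFin {n} {m} (finToFun {m} {n} j) ≡⟨ funToFin-finToFin {n} {m} j ⟩
  j                                   ∎
  where open ≡-Reasoning

subsets-pigeonhole : ∀ {n m} → m < 2 ^ n → (colour : (Fin n → Fin 2) → Fin m) →
  Σ (Fin n → Fin 2) λ X → Σ (Fin n → Fin 2) λ Y → ¬ (X ≗ Y) × colour X ≡ colour Y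
subsets-pigeonhole {n} m<2ⁿ colour
  with i , j , i<j , sameColour ← pigeonhole m<2ⁿ (colour ∘ finToFun {2} {n}) =
  finToFun i , finToFun j , (λ same → <⇒≢ i<j (finToFun-injective i j same)) , sameColour

-- If inserting X and inserting Y lead to the same representation, then the
-- algorithm cannot distinguish 1_X − 1_Y from the empty multiset: delete Y
-- after both streams.
indistinguishable-from-∅ : ∀ {n Q} (A : StreamingAlgorithm n Q) (u : SignedMultiset n → Q) →
  UniquelyRepresentedBy A u → (X Y : Fin n → Fin 2) →
  u (multisetOf (updatesOn true X)) ≡ u (multisetOf (updatesOn true Y)) →
  u (indicatorDifference X Y) ≡ u ∅
indistinguishable-from-∅ A u unique X Y sameState = begin
  u (indicatorDifference X Y)
    ≡⟨ cong u (sym (multisetOf-insert-delete X Y)) ⟩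
  u (multisetOf (updatesOn true X ++ updatesOn false Y))
    ≡⟨ collisions-persist A u unique (updatesOn true X) (updatesOn true Y) (updatesOn false Y) sameState ⟩
  u (multisetOf (updatesOn true Y ++ updatesOn false Y))
    ≡⟨ cong u (trans (multisetOf-insert-delete Y Y) (indicatorDifference-self Y)) ⟩
  u ∅ ∎
  where open ≡-Reasoning

theorem2 : (n k m : ℕ) → k < n → m ≤ 2 ^ k →
           (A : StreamingAlgorithm n (Fin m)) →
           (u : SignedMultiset n → Fin m) → UniquelyRepresentedBy A u →
           Σ (SignedMultiset n) (λ D → IsUnit D × D ≢ ∅ × u D ≡ u ∅)
theorem2 n k m k<n m≤2ᵏ A u unique
  with X , Y , X≉Y , sameState ←
         subsets-pigeonhole (≤-<-trans m≤2ᵏ (^-monoʳ-< 2 (s≤s (s≤s z≤n)) k<n))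
                            (u ∘ multisetOf ∘ updatesOn true)
  = indicatorDifference X Y
  , indicatorDifference-unit X Y
  , X≉Y ∘ indicatorDifference-empty X Y
  , indistinguishable-from-∅ A u unique X Y sameState
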